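{- Let $\mathcal{X},\mathcal{Y}$ be disjoint finite sets and let $Q=\mathcal{Q}(\mathcal{X}\cup\mathcal{Y})$ be colored blue/red with no blue copy of $\Lambda$. Let $X\subseteq\mathcal{X}$ and $Y\subseteq\mathcal{Y}$. Then $(X,Y)$ is embeddable if and only if either (i) $(X,Y)$ is blue and there is $Y'\subseteq\mathcal{Y}$ with $Y'\supsetneq Y$ such that $(X,Y')$ is embeddable, or (ii) $(X,Y)$ is red and for every $X'\subseteq\mathcal{X}$ with $X'\supsetneq X$, the vertex $(X',Y)$ is embeddable.
   Context: $\mathcal{Q}(\mathcal{S})$ is the Boolean lattice of all subsets of $\mathcal{S}$ ordered by inclusion. For $X\subseteq\mathcal{X}$, $Y\subseteq\mathcal{Y}$, $(X,Y)$ denotes the element $X\cup Y$ of $Q$. A poset embedding is an injective map $\phi$ with $a\le b$ iff $\phi(a)\le\phi(b)$. $\Lambda$ is the poset on $Z_1,Z_2,Z_3$ with $Z_1<Z_3$, $Z_2<Z_3$, $Z_1,Z_2$ incomparable; a blue copy of it is a set of blue elements of $Q$ which under inclusion is isomorphic to $\Lambda$. The vertex $(X,Y)$ is embeddable if there is an embedding $\phi$ of the poset $\{X'\subseteq\mathcal{X}: X'\supseteq X\}$ (ordered by inclusion) into $Q$ such that every $\phi(X')$ is red, $\phi(X')\cap\mathcal{X}=X'$ for all $X'$, and $\phi(X)\supseteq X\cup Y$. -}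

module Defs where

open import Data.Nat using (ℕ)
open import Data.Fin.Subset using (Subset; _⊆_)
open import Data.Product using (Σ; _×_; proj₁; proj₂; _,_)
open import Relation.Binary.PropositionalEquality using (_≡_)
open import Relation.Nullary using (¬_)
open import Function.Bundles using (_⇔_)

-- The ground set 𝒳 ∪ 𝒴 with 𝒳 = Fin m and 𝒴 = Fin n (disjoint).
-- An element of Q = 𝒬(𝒳 ∪ 𝒴) is a pair (X , Y) with X ⊆ 𝒳, Y ⊆ 𝒴,
-- representing the set X ∪ Y.
Q : ℕ → ℕ → Set
Q m n = Subset m × Subset n

_⊑_ : ∀ {m n} → Q m n → Q m n → Set
(X , Y) ⊑ (X' , Y') = (X ⊆ X') × (Y ⊆ Y')

infix 4 _⊑_

data Color : Set where
  red blue : Color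

Coloring : ℕ → ℕ → Set
Coloring m n = Q m n → Color

-- a blue copy of Λ: blue Z₁ Z₂ Z₃ with Z₁ < Z₃, Z₂ < Z₃, Z₁ ∥ Z₂
-- (strictness of Z₁ < Z₃ and Z₂ < Z₃, and distinctness, follow from the
--  incomparability of Z₁ and Z₂; we state strictness explicitly anyway)
IsBlueΛ : ∀ {m n} → Coloring m n → Q m n → Q m n → Q m n → Set
IsBlueΛ c Z₁ Z₂ Z₃ =
  (c Z₁ ≡ blue) × (c Z₂ ≡ blue) × (c Z₃ ≡ blue) ×
  (Z₁ ⊑ Z₃) × ¬ (Z₁ ≡ Z₃) × (Z₂ ⊑ Z₃) × ¬ (Z₂ ≡ Z₃) ×
  ¬ (Z₁ ⊑ Z₂) × ¬ (Z₂ ⊑ Z₁)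

NoBlueΛ : ∀ {m n} → Coloring m n → Set
NoBlueΛ c = ∀ Z₁ Z₂ Z₃ → ¬ IsBlueΛ c Z₁ Z₂ Z₃

-- (X , Y) is embeddable: there is an embedding φ of the poset
-- {X' ⊆ 𝒳 : X' ⊇ X} into Q (φ given as a total function, only its values
-- on supersets of X matter) with φ(X') red, φ(X') ∩ 𝒳 = X', φ(X) ⊇ X ∪ Y.
Embeddable : ∀ {m n} → Coloring m n → Subset m → Subset n → Set
Embeddable {m} {n} c X Y =
  Σ (Subset m → Q m n) λ φ →
    (∀ X₁ X₂ → X ⊆ X₁ → X ⊆ X₂ → φ X₁ ≡ φ X₂ → X₁ ≡ X₂) ×
    (∀ X₁ X₂ → X ⊆ X₁ → X ⊆ X₂ → (X₁ ⊆ X₂ ⇔ φ X₁ ⊑ φ X₂)) ×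
    (∀ X' → X ⊆ X' → c (φ X') ≡ red) ×
    (∀ X' → X ⊆ X' → proj₁ (φ X') ≡ X') ×
    ((X , Y) ⊑ φ X)

-- An embedding witnessing (X , Y) restricts to one witnessing (X' , Y) for
-- X' ⊇ X; if (X , Y) is blue, the red vertex φ(X) is (X , Y') with Y' ⊋ Y.
-- Conversely, for red (X , Y), map X' ⊇ X according to the blue vertices
-- (a , Y) with X ⊊ a ⊆ X': if two of them are incomparable, send X' to
-- (X' , 𝒴), which is red as it would otherwise complete a blue Λ; if there
-- are none, (X' , Y) is red; if they form a nonempty chain, use the given
-- embedding of its least element a. As X' grows the set of these blue vertices
-- only increases, so a does not change while they form a chain; this makes
-- the second coordinates monotone.
module Submission where

open import Defs
open import Data.Nat using (ℕ)
open import Data.Bool using (_≟_)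
open import Data.Fin.Properties using (any?)
open import Data.Fin.Subset using (Subset; _⊆_; _⊈_; _⊂_; ⊤)
open import Data.Fin.Subset.Properties
  using (_⊆?_; _⊂?_; _∈?_; anySubset?; ⊆-refl; ⊆-reflexive; ⊆-trans; ⊆-antisym; ⊆⊤)
open import Data.Fin.Subset.Induction using (⊂-wellFounded)
open import Data.Vec.Properties using (≡-dec)
open import Data.Product using (Σ; ∃; ∃₂; _×_; _,_; proj₁; proj₂)
open import Data.Sum using (_⊎_; inj₁; inj₂)
open import Data.Empty using (⊥-elim)
open import Function.Bundles using (_⇔_; mk⇔; Equivalence)
open import Induction.WellFounded using (Acc; acc)
open import Relation.Binary.Definitions using (DecidableEquality)
open import Relation.Binary.PropositionalEquality
  using (_≡_; _≢_; refl; sym; trans; cong; cong₂; subst)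
open import Relation.Nullary using (¬_; Dec; yes; no; contradiction)
open import Relation.Nullary.Decidable using (_×-dec_; ¬?; decidable-stable)

private
  variable
    m n : ℕ

_≟ᶜ_ : DecidableEquality Color
red  ≟ᶜ red  = yes refl
red  ≟ᶜ blue = no λ ()
blue ≟ᶜ red  = no λ ()
blue ≟ᶜ blue = yes refl

≢blue⇒≡red : ∀ {k} → k ≢ blue → k ≡ red
≢blue⇒≡red {red}  _     = refl
≢blue⇒≡red {blue} k≢blue = contradiction refl k≢blue

above-incomparable-blues-red : {c : Coloring m n} → NoBlueΛ c →
  ∀ {Z₁ Z₂ Z₃} → c Z₁ ≡ blue → c Z₂ ≡ blue → Z₁ ⊑ Z₃ → Z₂ ⊑ Z₃ →
  ¬ Z₁ ⊑ Z₂ → ¬ Z₂ ⊑ Z₁ → c Z₃ ≡ red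
above-incomparable-blues-red noΛ {Z₁} {Z₂} {Z₃} b₁ b₂ Z₁⊑Z₃ Z₂⊑Z₃ Z₁⋢Z₂ Z₂⋢Z₁ =
  ≢blue⇒≡red λ b₃ → noΛ Z₁ Z₂ Z₃
    ( b₁ , b₂ , b₃
    , Z₁⊑Z₃ , (λ { refl → Z₂⋢Z₁ Z₂⊑Z₃ })
    , Z₂⊑Z₃ , (λ { refl → Z₁⋢Z₂ Z₁⊑Z₃ })
    , Z₁⋢Z₂ , Z₂⋢Z₁ )

_≟ˢ_ : DecidableEquality (Subset m)
_≟ˢ_ = ≡-dec _≟_

⊆-resp : {A A′ B B′ : Subset m} → A′ ≡ A → B′ ≡ B → A ⊆ B → A′ ⊆ B′
⊆-resp refl refl A⊆B = A⊆B

⊆∧⊈⇒⊂ : {p q : Subset m} → p ⊆ q → q ⊈ p → p ⊂ q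
⊆∧⊈⇒⊂ {p = p} {q} p⊆q q⊈p with any? (λ x → x ∈? q ×-dec ¬? (x ∈? p))
... | yes (x , x∈q , x∉p) = p⊆q , x , x∈q , x∉p
... | no ∄ = contradiction
  (λ {x} x∈q → decidable-stable (x ∈? p) λ x∉p → ∄ (x , x∈q , x∉p)) q⊈p

⊂-minimal : {P : Subset m → Set} → (∀ a → Dec (P a)) → ∀ {a} → P a →
  ∃ λ z → P z × (∀ {b} → P b → ¬ b ⊂ z)
⊂-minimal {P = P} P? = go (⊂-wellFounded _)
  where
  go : ∀ {a} → Acc _⊂_ a → P a → ∃ λ z → P z × (∀ {b} → P b → ¬ b ⊂ z)
  go {a} (acc smaller) Pa with anySubset? (λ b → P? b ×-dec b ⊂? a)
  ... | yes (b , Pb , b⊂a) = go (smaller b⊂a) Pb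
  ... | no ∄ = a , Pa , λ {b} Pb b⊂a → ∄ (b , Pb , b⊂a)

HasIncomparablePair : (Subset m → Set) → Set
HasIncomparablePair P = ∃₂ λ a b → P a × P b × a ⊈ b × b ⊈ a

hasIncomparablePair? : {P : Subset m → Set} → (∀ a → Dec (P a)) →
  Dec (HasIncomparablePair P)
hasIncomparablePair? P? = anySubset? λ a → anySubset? λ b →
  P? a ×-dec P? b ×-dec ¬? (a ⊆? b) ×-dec ¬? (b ⊆? a)

hasIncomparablePair-mono : {P P′ : Subset m → Set} → (∀ {a} → P a → P′ a) →
  HasIncomparablePair P → HasIncomparablePair P′
hasIncomparablePair-mono P⇒P′ (a , b , Pa , Pb , a⊈b , b⊈a) =
  a , b , P⇒P′ Pa , P⇒P′ Pb , a⊈b , b⊈a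

⊆-least : {P : Subset m → Set} → (∀ a → Dec (P a)) → ¬ HasIncomparablePair P →
  ∀ {a} → P a → ∃ λ z → P z × (∀ {b} → P b → z ⊆ b)
⊆-least {P = P} P? chain Pa with ⊂-minimal P? Pa
... | z , Pz , minimal = z , Pz , least
  where
  least : ∀ {b} → P b → z ⊆ b
  least {b} Pb with z ⊆? b | b ⊆? z
  ... | yes z⊆b | _     = z⊆b
  ... | no z⊈b | yes b⊆z = contradiction (⊆∧⊈⇒⊂ b⊆z z⊈b) (minimal Pb)
  ... | no z⊈b | no b⊈z = contradiction (z , b , Pz , Pb , z⊈b , b⊈z) chain

-- Embeddable c X Y unfolds to Σ _ (IsEmbedding c X Y).
IsEmbedding : Coloring m n → Subset m → Subset n → (Subset m → Q m n) → Set
IsEmbedding c X Y φ =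
    (∀ X₁ X₂ → X ⊆ X₁ → X ⊆ X₂ → φ X₁ ≡ φ X₂ → X₁ ≡ X₂) ×
    (∀ X₁ X₂ → X ⊆ X₁ → X ⊆ X₂ → (X₁ ⊆ X₂ ⇔ φ X₁ ⊑ φ X₂)) ×
    (∀ X' → X ⊆ X' → c (φ X') ≡ red) ×
    (∀ X' → X ⊆ X' → proj₁ (φ X') ≡ X') ×
    ((X , Y) ⊑ φ X)

module Embedding (c : Coloring m n) {X Y φ} (e : IsEmbedding c X Y φ) where

  red-above : ∀ X' → X ⊆ X' → c (φ X') ≡ red
  red-above = proj₁ (proj₂ (proj₂ e))

  proj₁-above : ∀ X' → X ⊆ X' → proj₁ (φ X') ≡ X'
  proj₁-above = proj₁ (proj₂ (proj₂ (proj₂ e)))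

  monotone : ∀ {X₁ X₂} → X ⊆ X₁ → X₁ ⊆ X₂ → φ X₁ ⊑ φ X₂
  monotone {X₁} {X₂} X⊆X₁ X₁⊆X₂ =
    Equivalence.to (proj₁ (proj₂ e) X₁ X₂ X⊆X₁ (⊆-trans X⊆X₁ X₁⊆X₂)) X₁⊆X₂

  base : (X , Y) ⊑ φ X
  base = proj₂ (proj₂ (proj₂ (proj₂ e)))

  proj₂-above : ∀ {X'} → X ⊆ X' → Y ⊆ proj₂ (φ X')
  proj₂-above X⊆X' = ⊆-trans (proj₂ base) (proj₂ (monotone ⊆-refl X⊆X'))

-- Injectivity and order reflection come for free from φ(X') ∩ 𝒳 = X'.
mkIsEmbedding : (c : Coloring m n) {X : Subset m} {Y : Subset n}
  {φ : Subset m → Q m n} →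
  (∀ X' → X ⊆ X' → proj₁ (φ X') ≡ X') →
  (∀ {X₁ X₂} → X ⊆ X₁ → X₁ ⊆ X₂ → proj₂ (φ X₁) ⊆ proj₂ (φ X₂)) →
  (∀ X' → X ⊆ X' → c (φ X') ≡ red) →
  Y ⊆ proj₂ (φ X) →
  IsEmbedding c X Y φ
mkIsEmbedding c {X = X} {φ = φ} fst mono₂ isRed Y⊆φX =
  injective , order , isRed , fst , (⊆-reflexive (sym (fst X ⊆-refl)) , Y⊆φX)
  where
  injective : ∀ X₁ X₂ → X ⊆ X₁ → X ⊆ X₂ → φ X₁ ≡ φ X₂ → X₁ ≡ X₂
  injective X₁ X₂ h₁ h₂ φX₁≡φX₂ =
    trans (sym (fst X₁ h₁)) (trans (cong proj₁ φX₁≡φX₂) (fst X₂ h₂))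

  order : ∀ X₁ X₂ → X ⊆ X₁ → X ⊆ X₂ → (X₁ ⊆ X₂ ⇔ φ X₁ ⊑ φ X₂)
  order X₁ X₂ h₁ h₂ = mk⇔ to from
    where
    to : X₁ ⊆ X₂ → φ X₁ ⊑ φ X₂
    to X₁⊆X₂ = ⊆-resp (fst X₁ h₁) (fst X₂ h₂) X₁⊆X₂ , mono₂ h₁ X₁⊆X₂

    from : φ X₁ ⊑ φ X₂ → X₁ ⊆ X₂
    from φX₁⊑φX₂ = ⊆-resp (sym (fst X₁ h₁)) (sym (fst X₂ h₂)) (proj₁ φX₁⊑φX₂)

isEmbedding-rebase : (c : Coloring m n) {X : Subset m} {Y Y' : Subset n}
  {φ : Subset m → Q m n} →
  IsEmbedding c X Y φ → Y' ⊆ proj₂ (φ X) → IsEmbedding c X Y' φ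
isEmbedding-rebase c (inj , ord , isRed , fst , (X⊆ , _)) Y'⊆ =
  inj , ord , isRed , fst , (X⊆ , Y'⊆)

embeddable-downwardʸ : (c : Coloring m n) {X : Subset m} {Y Y' : Subset n} →
  Y ⊆ Y' → Embeddable c X Y' → Embeddable c X Y
embeddable-downwardʸ c Y⊆Y' (φ , e) =
  φ , isEmbedding-rebase c e (⊆-trans Y⊆Y' (proj₂ (Embedding.base c e)))

embeddable-upwardˣ : (c : Coloring m n) {X X' : Subset m} {Y : Subset n} →
  X ⊆ X' → Embeddable c X Y → Embeddable c X' Y
embeddable-upwardˣ c X⊆X' (φ , e) = φ , mkIsEmbedding c
  (λ X'' X'⊆X'' → proj₁-above X'' (⊆-trans X⊆X' X'⊆X''))
  (λ X'⊆X₁ X₁⊆X₂ → proj₂ (monotone (⊆-trans X⊆X' X'⊆X₁) X₁⊆X₂))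
  (λ X'' X'⊆X'' → red-above X'' (⊆-trans X⊆X' X'⊆X''))
  (proj₂-above X⊆X')
  where open Embedding c e

embeddable-blue⇒larger : (c : Coloring m n) {X : Subset m} {Y : Subset n} →
  Embeddable c X Y → c (X , Y) ≡ blue →
  Σ (Subset n) λ Y' → Y ⊆ Y' × Y' ≢ Y × Embeddable c X Y'
embeddable-blue⇒larger c {X} {Y} (φ , e) XY-blue =
  proj₂ (φ X) , proj₂ base , φX≢Y , (φ , isEmbedding-rebase c e ⊆-refl)
  where
  open Embedding c e

  φX≢Y : proj₂ (φ X) ≢ Y
  φX≢Y φX≡Y = contradiction (trans (sym XY-red) XY-blue) λ ()
    where
    XY-red : c (X , Y) ≡ red
    XY-red = subst (λ Z → c Z ≡ red)
      (cong₂ _,_ (proj₁-above X ⊆-refl) φX≡Y) (red-above X ⊆-refl)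

module RedExtension
  (c : Coloring m n) (noΛ : NoBlueΛ c) (X : Subset m) (Y : Subset n)
  (XY-red : c (X , Y) ≡ red)
  (embeddable-above : ∀ X' → X ⊆ X' → X' ≢ X → Embeddable c X' Y) where

  -- Independent of the proofs of X ⊊ a, so equal a give equal maps.
  embeddingAt : Subset m → Subset m → Q m n
  embeddingAt a with X ⊆? a | a ≟ˢ X
  ... | yes X⊆a | no a≢X = proj₁ (embeddable-above a X⊆a a≢X)
  ... | _       | _      = λ X' → X' , Y

  BlueBelow : Subset m → Subset m → Set
  BlueBelow X' a = X ⊆ a × a ≢ X × a ⊆ X' × c (a , Y) ≡ blue

  blueBelow? : ∀ X' a → Dec (BlueBelow X' a)
  blueBelow? X' a = X ⊆? a ×-dec ¬? (a ≟ˢ X) ×-dec a ⊆? X' ×-dec c (a , Y) ≟ᶜ blue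

  blueBelow-⊆ : ∀ {X' a} → BlueBelow X' a → a ⊆ X'
  blueBelow-⊆ (_ , _ , a⊆X' , _) = a⊆X'

  blue-at : ∀ {X' a} → BlueBelow X' a → c (a , Y) ≡ blue
  blue-at (_ , _ , _ , a-blue) = a-blue

  blueBelow-within : ∀ {X₁ X₂ a} → a ⊆ X₂ → BlueBelow X₁ a → BlueBelow X₂ a
  blueBelow-within a⊆X₂ (X⊆a , a≢X , _ , a-blue) = X⊆a , a≢X , a⊆X₂ , a-blue

  blueBelow-mono : ∀ {X₁ X₂ a} → X₁ ⊆ X₂ → BlueBelow X₁ a → BlueBelow X₂ a
  blueBelow-mono X₁⊆X₂ Ba = blueBelow-within (⊆-trans (blueBelow-⊆ Ba) X₁⊆X₂) Ba

  isEmbeddingAtBlue : ∀ {X' a} → BlueBelow X' a → IsEmbedding c a Y (embeddingAt a)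
  isEmbeddingAtBlue {a = a} (X⊆a , a≢X , _) with X ⊆? a | a ≟ˢ X
  ... | yes X⊆a′ | no a≢X′ = proj₂ (embeddable-above a X⊆a′ a≢X′)
  ... | yes _    | yes a≡X = contradiction a≡X a≢X
  ... | no X⊈a   | _       = ⊥-elim (X⊈a X⊆a)

  data Shape (X' : Subset m) : Set where
    incomparable : HasIncomparablePair (BlueBelow X') → Shape X'
    noBlue : (∀ a → ¬ BlueBelow X' a) → Shape X'
    leastBlue : ¬ HasIncomparablePair (BlueBelow X') → ∀ z → BlueBelow X' z →
                (∀ {b} → BlueBelow X' b → z ⊆ b) → Shape X'

  shape : ∀ X' → Shape X'
  shape X' with hasIncomparablePair? (blueBelow? X') | anySubset? (blueBelow? X')
  ... | yes inc   | _            = incomparable inc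
  ... | no _      | no ∄         = noBlue λ a Ba → ∄ (a , Ba)
  ... | no chain  | yes (_ , Ba) with ⊆-least (blueBelow? X') chain Ba
  ...   | z , Bz , least = leastBlue chain z Bz least

  image : ∀ {X'} → Shape X' → Q m n
  image {X'} (incomparable _)    = X' , ⊤
  image {X'} (noBlue _)          = X' , Y
  image {X'} (leastBlue _ z _ _) = embeddingAt z X'

  proj₁-image : ∀ {X'} (s : Shape X') → proj₁ (image s) ≡ X'
  proj₁-image (incomparable _) = refl
  proj₁-image (noBlue _)       = refl
  proj₁-image {X'} (leastBlue _ z Bz _) =
    Embedding.proj₁-above c (isEmbeddingAtBlue Bz) X' (blueBelow-⊆ Bz)

  proj₂-image : ∀ {X'} (s : Shape X') → Y ⊆ proj₂ (image s)
  proj₂-image (incomparable _)     = ⊆⊤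
  proj₂-image (noBlue _)           = ⊆-refl
  proj₂-image (leastBlue _ z Bz _) =
    Embedding.proj₂-above c (isEmbeddingAtBlue Bz) (blueBelow-⊆ Bz)

  image-red : ∀ {X'} → X ⊆ X' → (s : Shape X') → c (image s) ≡ red
  image-red _ (incomparable (a , b , Ba , Bb , a⊈b , b⊈a)) =
    above-incomparable-blues-red noΛ (blue-at Ba) (blue-at Bb) (blueBelow-⊆ Ba , ⊆⊤) (blueBelow-⊆ Bb , ⊆⊤)
      (λ le → a⊈b (proj₁ le)) (λ le → b⊈a (proj₁ le))
  image-red {X'} X⊆X' (noBlue ∄) with X' ≟ˢ X
  ... | yes refl = XY-red
  ... | no X'≢X  = ≢blue⇒≡red λ X'-blue → ∄ X' (X⊆X' , X'≢X , ⊆-refl , X'-blue)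
  image-red {X'} _ (leastBlue _ z Bz _) =
    Embedding.red-above c (isEmbeddingAtBlue Bz) X' (blueBelow-⊆ Bz)

  image-mono : ∀ {X₁ X₂} → X₁ ⊆ X₂ → (s₁ : Shape X₁) (s₂ : Shape X₂) →
    proj₂ (image s₁) ⊆ proj₂ (image s₂)
  image-mono _ _ (incomparable _) = ⊆⊤
  image-mono X₁⊆X₂ (incomparable (a , _ , Ba , _)) (noBlue ∄) =
    contradiction (blueBelow-mono X₁⊆X₂ Ba) (∄ a)
  image-mono X₁⊆X₂ (incomparable inc) (leastBlue chain _ _ _) =
    contradiction (hasIncomparablePair-mono (blueBelow-mono X₁⊆X₂) inc) chain
  image-mono _ (noBlue _) s₂ = proj₂-image s₂
  image-mono X₁⊆X₂ (leastBlue _ z Bz _) (noBlue ∄) =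
    contradiction (blueBelow-mono X₁⊆X₂ Bz) (∄ z)
  image-mono {X₁} {X₂} X₁⊆X₂
    (leastBlue _ z₁ Bz₁ least₁) (leastBlue _ z₂ Bz₂ least₂) =
    subst (λ z → proj₂ (embeddingAt z₁ X₁) ⊆ proj₂ (embeddingAt z X₂)) z₁≡z₂
      (proj₂ (Embedding.monotone c (isEmbeddingAtBlue Bz₁) (blueBelow-⊆ Bz₁) X₁⊆X₂))
    where
    z₂⊆z₁ : z₂ ⊆ z₁
    z₂⊆z₁ = least₂ (blueBelow-mono X₁⊆X₂ Bz₁)

    z₁≡z₂ : z₁ ≡ z₂
    z₁≡z₂ = ⊆-antisym
      (least₁ (blueBelow-within (⊆-trans z₂⊆z₁ (blueBelow-⊆ Bz₁)) Bz₂)) z₂⊆z₁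

  embeddable : Embeddable c X Y
  embeddable = (λ X' → image (shape X')) , mkIsEmbedding c
    (λ X' _ → proj₁-image (shape X'))
    (λ {X₁} {X₂} _ X₁⊆X₂ → image-mono X₁⊆X₂ (shape X₁) (shape X₂))
    (λ X' X⊆X' → image-red X⊆X' (shape X'))
    (proj₂-image (shape X))

lemma15 : (m n : ℕ) (c : Coloring m n) → NoBlueΛ c →
    (X : Subset m) (Y : Subset n) →
    Embeddable c X Y ⇔
      ((c (X , Y) ≡ blue ×
          Σ (Subset n) (λ Y' → Y ⊆ Y' × ¬ (Y' ≡ Y) × Embeddable c X Y'))
       ⊎
       (c (X , Y) ≡ red ×
          ((X' : Subset m) → X ⊆ X' → ¬ (X' ≡ X) → Embeddable c X' Y)))
lemma15 m n c noΛ X Y = mk⇔ forward backward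
  where
  forward : Embeddable c X Y → _
  forward E with c (X , Y) in XY-colour
  ... | red  = inj₂ (XY-colour , λ X' (X⊆X' : X ⊆ X') _ → embeddable-upwardˣ c X⊆X' E)
  ... | blue = inj₁ (XY-colour , embeddable-blue⇒larger c E XY-colour)

  backward : _ → Embeddable c X Y
  backward (inj₁ (_ , _ , Y⊆Y' , _ , E)) = embeddable-downwardʸ c Y⊆Y' E
  backward (inj₂ (XY-red , above)) = RedExtension.embeddable c noΛ X Y XY-red above
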